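{- For all natural numbers $c,j$, $M_{2c}^0\big(2^{c+1}(j+1)\big)\ge 2^{j^{c+1}}$.
   Context: $K$ is a field. A monomial in $K[X_d,\dots,X_0,Y]$ is a polynomial $X_d^{i_d}\cdots X_0^{i_0}Y^j$, of degree $i_d+\dots+i_0+j$. A monomial ideal is an ideal generated by monomials; the degree of a finite set of monomials is the maximum degree of its elements, and $\mathrm{deg}(I)$ for a monomial ideal $I$ is the minimum degree of a finite set of monomials generating $I$. For natural numbers $d,l$, $M_d^0(l)$ denotes the least $M$ such that for every sequence $I_0,\dots,I_M$ of monomial ideals in $K[X_d,\dots,X_0,Y]$ with $\mathrm{deg}(I_i)\le l$ for all $i\le M$ there exist $i<j\le M$ with $I_i\supseteq I_j$. -}

module Defs where

open import Data.Nat using (ℕ; suc; _≤_; _+_; _*_; _^_)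
open import Data.Fin using (Fin; _<_)
open import Data.Vec using (Vec; sum)
open import Data.Vec.Relation.Binary.Pointwise.Inductive using (Pointwise)
open import Data.List using (List)
open import Data.List.Relation.Unary.All using (All)
open import Data.List.Relation.Unary.Any using (Any)
open import Data.Product using (Σ; ∃; _×_)

-- A monomial in K[X_d,...,X_0,Y] (d+2 variables) is its exponent vector.
Monomial : ℕ → Set
Monomial d = Vec ℕ (suc (suc d))

degree : ∀ {d} → Monomial d → ℕ
degree = sum

_∣ₘ_ : ∀ {d} → Monomial d → Monomial d → Set
m ∣ₘ n = Pointwise _≤_ m n

Generators : ℕ → Set
Generators d = List (Monomial d)

-- A monomial m lies in the monomial ideal generated by G iff some generator divides it.
-- (A monomial ideal is determined by the monomials it contains.)
_∈⟨_⟩ : ∀ {d} → Monomial d → Generators d → Set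
m ∈⟨ G ⟩ = Any (λ g → g ∣ₘ m) G

_⊇ᵢ_ : ∀ {d} → Generators d → Generators d → Set
G ⊇ᵢ H = ∀ m → m ∈⟨ H ⟩ → m ∈⟨ G ⟩

DegAtMost : ∀ {d} → ℕ → Generators d → Set
DegAtMost l G = All (λ g → degree g ≤ l) G

-- A monomial ideal I has deg(I) ≤ l iff it is generated by a finite set of
-- monomials of degree ≤ l.  So a sequence I_0,...,I_M of monomial ideals of
-- degree ≤ l is given by generating sets G : Fin (M+1) → Generators d with
-- each G i of degree ≤ l.
-- Property defining M_d^0(l): M satisfies it iff every such sequence has
-- i < j ≤ M with I_i ⊇ I_j.
HasM0Property : ℕ → ℕ → ℕ → Set
HasM0Property d l M =
  (G : Fin (suc M) → Generators d) →
  (∀ i → DegAtMost l (G i)) →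
  Σ (Fin (suc M)) λ i → Σ (Fin (suc M)) λ j → (i < j) × (G i ⊇ᵢ G j)

-- "M_d^0(l) ≥ N": since M_d^0(l) is the least M with the property,
-- this means every M with the property is ≥ N.
M0-atLeast : ℕ → ℕ → ℕ → Set
M0-atLeast d l N = ∀ M → HasM0Property d l M → N ≤ M

{-# OPTIONS --safe #-}
-- If L is an antichain for divisibility, no element of L lies in
-- the ideal generated by a sublist not containing it.  Listing the 2^|L|
-- sublists of L in binary order, a later sublist always contains an element
-- missing from an earlier one, so these ideals form a sequence without
-- I_i ⊇ I_j for i < j.  An antichain of j^(c+1) monomials in 2c+2 variables,
-- all of degree (c+1)j, is given by the products of c+1 points of the
-- diagonals a + b = j with a < j in consecutive pairs of variables.
module Submission where

open import Defs
open import Level using (_⊔_)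
open import Function using (_∘_)
open import Data.Nat using (ℕ; zero; suc; _+_; _*_; _^_; _∸_; _≤_; _<_; _<?_; z≤n; s≤s)
open import Data.Nat.Properties
open import Data.Fin using (toℕ)
open import Data.Fin.Properties using (toℕ<n)
open import Data.Vec as Vec using (Vec; []; _∷_)
open import Data.Vec.Relation.Binary.Pointwise.Inductive as Pointwise using (Pointwise; _∷_)
open import Data.List using (List; []; _∷_; [_]; _++_; length; map)
open import Data.List.Properties using (length-++; length-map)
open import Data.List.Membership.Propositional using (_∈_)
open import Data.List.Relation.Binary.Subset.Propositional using (_⊆_)
open import Data.List.Relation.Binary.Subset.Propositional.Properties using (xs⊆x∷xs; ∷⁺ʳ; ⊆-trans)
open import Data.List.Relation.Unary.All as All using (All; []; _∷_)
open import Data.List.Relation.Unary.All.Properties using (anti-mono; All¬⇒¬Any; ++⁺; map⁺)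
open import Data.List.Relation.Unary.Any as Any using (Any; here; there)
open import Data.List.Relation.Unary.AllPairs as AllPairs using (AllPairs; []; _∷_)
import Data.List.Relation.Unary.AllPairs.Properties as AllPairs
open import Data.Product using (∃; _×_; _,_; proj₁; proj₂)
open import Relation.Binary using (Rel; Reflexive)
open import Relation.Binary.PropositionalEquality using (_≡_; refl; sym; trans; cong; cong₂; subst; module ≡-Reasoning)
open import Relation.Nullary using (¬_; yes; no; contradiction)

Incomparable : ∀ {a ℓ} {A : Set a} → Rel A ℓ → Rel A ℓ
Incomparable _≼_ x y = ¬ x ≼ y × ¬ y ≼ x

m<2^[1+n]⇒m∸2^n<2^n : ∀ m n → m < 2 ^ suc n → m ∸ 2 ^ n < 2 ^ n
m<2^[1+n]⇒m∸2^n<2^n m n m<2^[1+n] = m<n+o⇒m∸n<o m (2 ^ n) {{m^n≢0 2 n}}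
  (subst (m <_) (cong (2 ^ n +_) (+-identityʳ (2 ^ n))) m<2^[1+n])

n<2^n : ∀ n → n < 2 ^ n
n<2^n zero    = s≤s z≤n
n<2^n (suc n) = subst (suc n <_) (cong (2 ^ n +_) (sym (+-identityʳ (2 ^ n))))
  (+-mono-≤ (m^n>0 2 n) (n<2^n n))

module _ {a} {A : Set a} where

  -- The i-th sublist for i < 2 ^ length L: the head of L is kept iff the
  -- most significant of the length L binary digits of i is 1.
  binarySublist : List A → ℕ → List A
  binarySublist []      i = []
  binarySublist (x ∷ L) i with i <? 2 ^ length L
  ... | yes _ = binarySublist L i
  ... | no  _ = x ∷ binarySublist L (i ∸ 2 ^ length L)

  binarySublist-⊆ : ∀ L i → binarySublist L i ⊆ L
  binarySublist-⊆ []      i = λ ()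
  binarySublist-⊆ (x ∷ L) i with i <? 2 ^ length L
  ... | yes _ = ⊆-trans (binarySublist-⊆ L i) (xs⊆x∷xs L x)
  ... | no  _ = ∷⁺ʳ x (binarySublist-⊆ L (i ∸ 2 ^ length L))

module UpwardClosure {a ℓ} {A : Set a} (_≼_ : Rel A ℓ) where

  _∈↑_ : A → List A → Set (a ⊔ ℓ)
  x ∈↑ G = Any (_≼ x) G

  _⊇↑_ : List A → List A → Set (a ⊔ ℓ)
  G ⊇↑ H = ∀ x → x ∈↑ H → x ∈↑ G

  ∉↑-incomparable : ∀ {x L S} → All (Incomparable _≼_ x) L → S ⊆ L → ¬ x ∈↑ S
  ∉↑-incomparable x⊥L S⊆L = All¬⇒¬Any (All.map proj₂ (anti-mono S⊆L x⊥L))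

  binarySublist-separated : ∀ L → AllPairs (Incomparable _≼_) L →
    ∀ {i j} → i < j → j < 2 ^ length L →
    ∃ λ y → y ∈ binarySublist L j × ¬ y ∈↑ binarySublist L i
  binarySublist-separated [] _ {j = zero}  ()  _
  binarySublist-separated [] _ {j = suc _} _   (s≤s ())
  binarySublist-separated (x ∷ L) (x⊥L ∷ antichain) {i} {j} i<j j<2^N
    with i <? 2 ^ length L | j <? 2 ^ length L
  ... | yes _   | yes j<2^n = binarySublist-separated L antichain i<j j<2^n
  ... | yes _   | no  _     = x , here refl , ∉↑-incomparable x⊥L (binarySublist-⊆ L i)
  ... | no  i≮n | yes j<2^n = contradiction (<-trans i<j j<2^n) i≮n
  ... | no  i≮n | no  _     with binarySublist-separated L antichain
                                   (∸-monoˡ-< i<j (≮⇒≥ i≮n))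
                                   (m<2^[1+n]⇒m∸2^n<2^n j (length L) j<2^N)
  ...   | y , y∈Lⱼ , y∉↑Lᵢ = y , there y∈Lⱼ , y∉↑x∷Lᵢ
    where
    y∉↑x∷Lᵢ : ¬ y ∈↑ (x ∷ binarySublist L (i ∸ 2 ^ length L))
    y∉↑x∷Lᵢ (here x≼y)  = proj₁ (All.lookup x⊥L (binarySublist-⊆ L _ y∈Lⱼ)) x≼y
    y∉↑x∷Lᵢ (there y∈↑) = y∉↑Lᵢ y∈↑

  binarySublist-not-⊇ : Reflexive _≼_ → ∀ L → AllPairs (Incomparable _≼_) L →
    ∀ {i j} → i < j → j < 2 ^ length L → ¬ (binarySublist L i ⊇↑ binarySublist L j)
  binarySublist-not-⊇ ≼-refl L antichain i<j j<2^N Lᵢ⊇Lⱼ =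
    let y , y∈Lⱼ , y∉↑Lᵢ = binarySublist-separated L antichain i<j j<2^N
    in y∉↑Lᵢ (Lᵢ⊇Lⱼ y (Any.map (λ { refl → ≼-refl }) y∈Lⱼ))

antichain⇒M0-atLeast : ∀ {d l} (L : Generators d) → AllPairs (Incomparable _∣ₘ_) L →
  DegAtMost l L → M0-atLeast d l (2 ^ length L)
antichain⇒M0-atLeast {d} L antichain deg≤ M hasM0 = ≮⇒≥ λ M<2^N →
  let i , j , i<j , Gᵢ⊇Gⱼ = hasM0 (binarySublist L ∘ toℕ) (λ i → anti-mono (binarySublist-⊆ L (toℕ i)) deg≤)
  in binarySublist-not-⊇ (Pointwise.refl ≤-refl) L antichain i<j (<-≤-trans (toℕ<n j) M<2^N) Gᵢ⊇Gⱼ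
  where open UpwardClosure (_∣ₘ_ {d})

module Staircase (j : ℕ) where

  _≤ᵥ_ : ∀ {n} → Rel (Vec ℕ n) _
  _≤ᵥ_ = Pointwise _≤_

  diagonalProduct : ℕ → ∀ {n} → List (Vec ℕ n) → List (Vec ℕ (2 + n))
  diagonalProduct zero    P = []
  diagonalProduct (suc k) P = map (λ v → k ∷ (j ∸ k) ∷ v) P ++ diagonalProduct k P

  staircase : ∀ c → List (Vec ℕ (c * 2))
  staircase zero    = [ [] ]
  staircase (suc c) = diagonalProduct j (staircase c)

  length-diagonalProduct : ∀ k {n} (P : List (Vec ℕ n)) → length (diagonalProduct k P) ≡ k * length P
  length-diagonalProduct zero    P = refl
  length-diagonalProduct (suc k) P = begin
    length (map _ P ++ diagonalProduct k P)         ≡⟨ length-++ (map _ P) ⟩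
    length (map _ P) + length (diagonalProduct k P) ≡⟨ cong₂ _+_ (length-map _ P) (length-diagonalProduct k P) ⟩
    length P + k * length P                         ∎
    where open ≡-Reasoning

  length-staircase : ∀ c → length (staircase c) ≡ j ^ c
  length-staircase zero    = refl
  length-staircase (suc c) = trans (length-diagonalProduct j (staircase c)) (cong (j *_) (length-staircase c))

  sum-diagonalPoint : ∀ {k n} (v : Vec ℕ n) → k ≤ j → Vec.sum (k ∷ (j ∸ k) ∷ v) ≡ j + Vec.sum v
  sum-diagonalPoint {k} v k≤j = trans (sym (+-assoc k (j ∸ k) (Vec.sum v))) (cong (_+ Vec.sum v) (m+[n∸m]≡n k≤j))

  sum-diagonalProduct : ∀ {k n s} {P : List (Vec ℕ n)} → k ≤ j →
    All (λ v → Vec.sum v ≡ s) P → All (λ v → Vec.sum v ≡ j + s) (diagonalProduct k P)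
  sum-diagonalProduct {zero}  _   _   = []
  sum-diagonalProduct {suc k} k<j sum≡ =
    ++⁺ (map⁺ (All.map (λ {v} v≡ → trans (sum-diagonalPoint v (<⇒≤ k<j)) (cong (j +_) v≡)) sum≡))
        (sum-diagonalProduct (<⇒≤ k<j) sum≡)

  sum-staircase : ∀ c → All (λ v → Vec.sum v ≡ c * j) (staircase c)
  sum-staircase zero    = refl ∷ []
  sum-staircase (suc c) = sum-diagonalProduct ≤-refl (sum-staircase c)

  NorthWestOf : ℕ → ∀ {n} → Vec ℕ (2 + n) → Set
  NorthWestOf k (a ∷ b ∷ _) = a < k × j ∸ k < b

  northWest⇒incomparable : ∀ {k n} (v : Vec ℕ n) {u} → NorthWestOf k u →
    Incomparable _≤ᵥ_ (k ∷ (j ∸ k) ∷ v) u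
  northWest⇒incomparable v {a ∷ b ∷ _} (a<k , j∸k<b) =
    (λ { (k≤a ∷ _) → <⇒≱ a<k k≤a }) , (λ { (_ ∷ b≤j∸k ∷ _) → <⇒≱ j∸k<b b≤j∸k })

  diagonalProduct-northWest : ∀ {k K n} {P : List (Vec ℕ n)} → k ≤ K → K ≤ j →
    All (NorthWestOf K) (diagonalProduct k P)
  diagonalProduct-northWest {zero}  _   _   = []
  diagonalProduct-northWest {suc k} k<K K≤j =
    ++⁺ (map⁺ (All.universal (λ _ → k<K , ∸-monoʳ-< k<K K≤j) _))
        (diagonalProduct-northWest (<⇒≤ k<K) K≤j)

  diagonalProduct-antichain : ∀ {k n} {P : List (Vec ℕ n)} → k ≤ j →
    AllPairs (Incomparable _≤ᵥ_) P → AllPairs (Incomparable _≤ᵥ_) (diagonalProduct k P)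
  diagonalProduct-antichain {zero}  _   _         = []
  diagonalProduct-antichain {suc k} k<j antichain =
    AllPairs.++⁺ (AllPairs.map⁺ (AllPairs.map prefix antichain))
                 (diagonalProduct-antichain (<⇒≤ k<j) antichain)
                 (map⁺ (All.universal (λ v → All.map (northWest⇒incomparable v)
                                                      (diagonalProduct-northWest ≤-refl (<⇒≤ k<j))) _))
    where
    prefix : ∀ {v w} → Incomparable _≤ᵥ_ v w → Incomparable _≤ᵥ_ (k ∷ (j ∸ k) ∷ v) (k ∷ (j ∸ k) ∷ w)
    prefix (v≰w , w≰v) = (λ { (_ ∷ _ ∷ v≤w) → v≰w v≤w }) , (λ { (_ ∷ _ ∷ w≤v) → w≰v w≤v })

  staircase-antichain : ∀ c → AllPairs (Incomparable _≤ᵥ_) (staircase c)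
  staircase-antichain zero    = [] ∷ []
  staircase-antichain (suc c) = diagonalProduct-antichain ≤-refl (staircase-antichain c)

mainTheorem8 : ∀ (c j : ℕ) →
    M0-atLeast (2 * c) ((2 ^ (c + 1)) * (j + 1)) (2 ^ (j ^ (c + 1)))
mainTheorem8 c j rewrite *-comm 2 c | +-comm c 1 =
  subst (λ N → M0-atLeast (c * 2) (2 ^ suc c * (j + 1)) (2 ^ N)) (length-staircase (suc c))
    (antichain⇒M0-atLeast (staircase (suc c)) (staircase-antichain (suc c))
      (All.map (λ sum≡ → ≤-trans (≤-reflexive sum≡) degree≤) (sum-staircase (suc c))))
  where
  open Staircase j
  degree≤ : suc c * j ≤ 2 ^ suc c * (j + 1)
  degree≤ = *-mono-≤ (<⇒≤ (n<2^n (suc c))) (m≤m+n j 1)
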